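{- Let $n\ge 1$. For the game of Cops and Robbers on the lattice graph $\mathbb{Z}^n$, there exists a placement of (infinitely many) cops whose set $\mathcal{A}\subseteq\mathbb{Z}^n$ of starting positions has density $d_{\mathcal{A}}=0$, and such that the cops have a strategy that captures the robber in finitely many moves, whatever starting vertex and moves the robber chooses.
   Context: The graph $\mathbb{Z}^n$ has vertex set $\{(x_1,\dots,x_n):x_i\in\mathbb{Z}\}$, with $u,v$ adjacent iff $\|u-v\|_1=1$. Game of Cops and Robbers: first the cops are each placed on a vertex (several cops may share a vertex; there may be infinitely many cops); then the robber chooses a starting vertex. Then the players alternate turns, the robber moving first. On a turn, each cop (resp. the robber) moves to an adjacent vertex or stays where it is. The cops win (capture the robber) if at the end of some cops' turn some cop occupies the robber's vertex; the robber wins if he evades capture forever. "The cops can catch the robber" means the cops have a strategy guaranteeing capture in finitely many moves against every robber starting position and strategy. For $A\subseteq\mathbb{Z}^n$, the density of $A$ is $d_A=\lim_{m\to\infty}\frac{|A\cap[-m,m]^n|}{|[-m,m]^n|}$, where $[-m,m]^n$ denotes the lattice points of that cube; the density of a set of cops is the density of the set of their starting vertices. -}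

module Defs where

open import Level using (0ℓ)
open import Data.Nat as ℕ using (ℕ; zero; suc; _≤_; _^_)
open import Data.Integer as ℤ using (ℤ; +_; _-_; ∣_∣)
open import Data.Vec using (Vec; []; _∷_)
open import Data.List using (List; []; _∷_; map; concatMap; upTo; applyUpTo; length)
open import Data.Bool using (Bool; true; false; if_then_else_)
open import Data.Product using (Σ; ∃; _×_)
open import Relation.Binary.PropositionalEquality using (_≡_)

Point : ℕ → Set
Point n = Vec ℤ n

dist₁ : ∀ {n} → Point n → Point n → ℕ
dist₁ []       []       = 0
dist₁ (x ∷ xs) (y ∷ ys) = ∣ x - y ∣ ℕ.+ dist₁ xs ys

Adjacent : ∀ {n} → Point n → Point n → Set
Adjacent u v = dist₁ u v ≡ 1

Step : ∀ {n} → Point n → Point n → Set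
Step u v = Adjacent u v Data.Sum.⊎ (u ≡ v)
  where import Data.Sum

range : ℕ → List ℤ
range m = map (λ k → (+ k) - (+ m)) (upTo (suc (2 ℕ.* m)))

box : (n m : ℕ) → List (Point n)
box zero    m = [] ∷ []
box (suc n) m = concatMap (λ x → map (x ∷_) (box n m)) (range m)

count : ∀ {A : Set} → (A → Bool) → List A → ℕ
count P []       = 0
count P (x ∷ xs) = if P x then suc (count P xs) else count P xs

boxCount : ∀ n → (Point n → Bool) → ℕ → ℕ
boxCount n A m = count A (box n m)

-- d_A = 0, i.e. lim_{m→∞} |A ∩ [-m,m]^n| / (2m+1)^n = 0, unfolded:
-- for every k ≥ 1 there is M with |A ∩ [-m,m]^n| / (2m+1)^n ≤ 1/k for all m ≥ M.
DensityZero : ∀ n → (Point n → Bool) → Set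
DensityZero n A =
  ∀ (k : ℕ) → 1 ≤ k → ∃ λ (M : ℕ) → ∀ (m : ℕ) → M ≤ m →
    k ℕ.* boxCount n A m ≤ (suc (2 ℕ.* m)) ^ n

-- A robber play: r 0 is the robber's starting vertex, r (t+1) his position
-- after his (t+1)-th move.  Legal if every move is a Step.
LegalRobber : ∀ {n} → (ℕ → Point n) → Set
LegalRobber r = ∀ t → Step (r t) (r (suc t))

-- A cop strategy for cops indexed by I: given the robber's history
-- r 0, …, r (t+1) (the robber moves first), the positions of all cops after
-- their (t+1)-th move.  (Cops' own past positions are determined by the
-- strategy and the robber history, so this is full information.)
CopStrategy : Set → ℕ → Set
CopStrategy I n = List (Point n) → I → Point n

copsAt : ∀ {I n} → (I → Point n) → CopStrategy I n → (ℕ → Point n) → ℕ → I → Point n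
copsAt start σ r zero    = start
copsAt start σ r (suc t) = σ (applyUpTo r (suc (suc t)))

LegalCops : ∀ {I n} → (I → Point n) → CopStrategy I n → Set
LegalCops {I} start σ =
  ∀ r → LegalRobber r → ∀ t (i : I) → Step (copsAt start σ r t i) (copsAt start σ r (suc t) i)

Captures : ∀ {I n} → (I → Point n) → CopStrategy I n → Set
Captures {I} start σ =
  ∀ r → LegalRobber r → ∃ λ (t : ℕ) → ∃ λ (i : I) → copsAt start σ r (suc t) i ≡ r (suc t)

IsStartSet : ∀ {I n} → (I → Point n) → (Point n → Bool) → Set
IsStartSet {I} start A =
  (∀ i → A (start i) ≡ true) × (∀ p → A p ≡ true → ∃ λ (i : I) → start i ≡ p)

{-# OPTIONS --safe #-}

-- Put cops on the hyperplanes |x₁| = R for every perfect square R: on each such vertex stand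
-- cops with every delay d ∈ ℕ, a cop idling for d turns and then walking one step per turn
-- towards the hyperplane x₁ = 0.  The cube [-m,m]ⁿ meets these hyperplanes in at most
-- 2(√m + 1)(2m+1)ⁿ⁻¹ points, so the start set has density zero.  The robber changes |x₁| by at
-- most one per move, so for a square R beyond his first position there is a time τ with
-- |x₁| ≤ R ≤ |x₁| + τ; the cop at distance R on the robber's side, in the robber's other
-- coordinates and with delay τ − (R − |x₁|), lands on him at time τ.

module Submission where

open import Defs
open import Data.Bool using (Bool; true; false; if_then_else_; T)
open import Data.Integer as ℤ using (ℤ; -[1+_]; _-_; ∣_∣; sign; _◃_)
import Data.Integer.Properties as ℤ
import Data.Integer.Tactic.RingSolver as ℤ-Solver
open import Data.List using (List; []; _∷_; [_]; _++_; _∷ʳ_; map; concatMap; upTo; applyUpTo; length)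
open import Data.List.Properties
  using (applyUpTo-∷ʳ; upTo-∷ʳ; map-upTo; map-cong; length-map; length-++; length-applyUpTo; length-upTo)
open import Data.Nat as ℕ using (ℕ; zero; suc; pred; _+_; _*_; _∸_; _^_; _≤_; _≤ᵇ_; z≤n; s≤s)
open import Data.Nat.Properties
import Data.Nat.Tactic.RingSolver as ℕ-Solver
open import Data.Product using (Σ; ∃; _×_; _,_)
open import Data.Sum using (inj₁; inj₂)
open import Data.Unit using (tt)
import Data.Sign as Sign
open import Data.Vec using ([]; _∷_; head)
open import Function using (_∘_)
open import Relation.Nullary using (yes; no)
open import Relation.Binary.PropositionalEquality hiding ([_])

private
  variable
    A B : Set

count-∷ : ∀ (P : A → Bool) x xs → count P (x ∷ xs) ≡ count P [ x ] + count P xs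
count-∷ P x xs with P x
... | true  = refl
... | false = refl

count-++ : ∀ (P : A → Bool) xs ys → count P (xs ++ ys) ≡ count P xs + count P ys
count-++ P []       ys = refl
count-++ P (x ∷ xs) ys = begin
  count P (x ∷ xs ++ ys)                   ≡⟨ count-∷ P x (xs ++ ys) ⟩
  count P [ x ] + count P (xs ++ ys)       ≡⟨ cong (count P [ x ] +_) (count-++ P xs ys) ⟩
  count P [ x ] + (count P xs + count P ys) ≡⟨ +-assoc (count P [ x ]) _ _ ⟨
  (count P [ x ] + count P xs) + count P ys ≡⟨ cong (_+ count P ys) (count-∷ P x xs) ⟨
  count P (x ∷ xs) + count P ys             ∎
  where open ≡-Reasoning

count-map : ∀ (P : B → Bool) (f : A → B) xs → count P (map f xs) ≡ count (P ∘ f) xs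
count-map P f []       = refl
count-map P f (x ∷ xs) with P (f x)
... | true  = cong suc (count-map P f xs)
... | false = count-map P f xs

count-const : ∀ b (xs : List A) → count (λ _ → b) xs ≡ (if b then 1 else 0) * length xs
count-const true  []       = refl
count-const true  (x ∷ xs) = cong suc (count-const true xs)
count-const false []       = refl
count-const false (x ∷ xs) = count-const false xs

count-upTo-suc : ∀ (P : ℕ → Bool) m → count P (upTo (suc m)) ≡ count P (upTo m) + count P [ m ]
count-upTo-suc P m = trans (cong (count P) (sym (upTo-∷ʳ m))) (count-++ P (upTo m) [ m ])

range-suc : ∀ m → range (suc m) ≡ -[1+ m ] ∷ range m ∷ʳ ℤ.+ suc m
range-suc m = begin
  range (suc m)
    ≡⟨ map-upTo f (suc (2 * suc m)) ⟩
  applyUpTo f (suc (2 * suc m))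
    ≡⟨ cong (applyUpTo f ∘ suc) (*-suc 2 m) ⟩
  f 0 ∷ applyUpTo (f ∘ suc) (suc (suc (2 * m)))
    ≡⟨ cong (f 0 ∷_) (applyUpTo-∷ʳ (f ∘ suc) (suc (2 * m))) ⟨
  f 0 ∷ applyUpTo (f ∘ suc) (suc (2 * m)) ∷ʳ f (2 + 2 * m)
    ≡⟨ cong₂ (λ xs y → f 0 ∷ xs ∷ʳ y) shift last ⟩
  -[1+ m ] ∷ range m ∷ʳ ℤ.+ suc m
    ∎
  where
  open ≡-Reasoning
  f : ℕ → ℤ
  f k = ℤ.+ k - ℤ.+ suc m
  shift : applyUpTo (f ∘ suc) (suc (2 * m)) ≡ range m
  shift = trans (sym (map-upTo (f ∘ suc) (suc (2 * m)))) (map-cong f∘suc≗ (upTo (suc (2 * m))))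
    where
    f∘suc≗ : ∀ k → f (suc k) ≡ ℤ.+ k - ℤ.+ m
    f∘suc≗ k = trans (ℤ.[1+m]⊖[1+n]≡m⊖n k m) (sym (ℤ.[+m]-[+n]≡m⊖n k m))
  last : f (2 + 2 * m) ≡ ℤ.+ suc m
  last = begin
    suc (suc (2 * m)) ℤ.⊖ suc m ≡⟨ ℤ.[1+m]⊖[1+n]≡m⊖n (suc (2 * m)) m ⟩
    suc (2 * m) ℤ.⊖ m           ≡⟨ ℤ.⊖-≥ (m≤n⇒m≤1+n (m≤m+n m (m + 0))) ⟩
    ℤ.+ (suc (2 * m) ∸ m)       ≡⟨ cong (λ k → ℤ.+ (suc (m + k) ∸ m)) (+-identityʳ m) ⟩
    ℤ.+ (suc m + m ∸ m)         ≡⟨ cong ℤ.+_ (m+n∸n≡m (suc m) m) ⟩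
    ℤ.+ suc m                   ∎

count-abs-range : ∀ (S : ℕ → Bool) m → count (S ∘ ∣_∣) (range m) ≤ 2 * count S (upTo (suc m))
count-abs-range S zero    = m≤m+n _ _
count-abs-range S (suc m) = begin
  count (S ∘ ∣_∣) (range (suc m))
    ≡⟨ cong (count (S ∘ ∣_∣)) (range-suc m) ⟩
  count (S ∘ ∣_∣) (-[1+ m ] ∷ range m ∷ʳ ℤ.+ suc m)
    ≡⟨ count-∷ (S ∘ ∣_∣) -[1+ m ] (range m ∷ʳ ℤ.+ suc m) ⟩
  b + count (S ∘ ∣_∣) (range m ∷ʳ ℤ.+ suc m)
    ≡⟨ cong (b +_) (count-++ (S ∘ ∣_∣) (range m) _) ⟩
  b + (count (S ∘ ∣_∣) (range m) + b)
    ≤⟨ +-monoʳ-≤ b (+-monoˡ-≤ b (count-abs-range S m)) ⟩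
  b + (2 * c + b)
    ≡⟨ regroup b c ⟩
  2 * (c + b)
    ≡⟨ cong (2 *_) (count-upTo-suc S (suc m)) ⟨
  2 * count S (upTo (suc (suc m)))
    ∎
  where
  open ≤-Reasoning
  b = count S [ suc m ]
  c = count S (upTo (suc m))
  regroup : ∀ b c → b + (2 * c + b) ≡ 2 * (c + b)
  regroup = ℕ-Solver.solve-∀

length-range : ∀ m → length (range m) ≡ suc (2 * m)
length-range m = trans (length-map _ (upTo (suc (2 * m)))) (length-upTo (suc (2 * m)))

length-box : ∀ n m → length (box n m) ≡ suc (2 * m) ^ n
length-box zero    m = refl
length-box (suc n) m = trans (length-prefixes (range m)) (cong₂ _*_ (length-range m) (length-box n m))
  where
  length-prefixes : ∀ xs →
                    length (concatMap (λ x → map (x ∷_) (box n m)) xs) ≡ length xs * length (box n m)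
  length-prefixes []       = refl
  length-prefixes (x ∷ xs) = trans (length-++ (map (x ∷_) (box n m)))
    (cong₂ _+_ (length-map (x ∷_) (box n m)) (length-prefixes xs))

count-head-box : ∀ (Q : ℤ → Bool) n m →
                 count (Q ∘ head) (box (suc n) m) ≡ count Q (range m) * suc (2 * m) ^ n
count-head-box Q n m = trans (count-prefixes (range m)) (cong (count Q (range m) *_) (length-box n m))
  where
  L = box n m
  count-prefixes : ∀ xs →
                   count (Q ∘ head) (concatMap (λ x → map (x ∷_) L) xs) ≡ count Q xs * length L
  count-prefixes []       = refl
  count-prefixes (x ∷ xs) = begin
    count (Q ∘ head) (map (x ∷_) L ++ concatMap (λ x → map (x ∷_) L) xs)
      ≡⟨ count-++ (Q ∘ head) (map (x ∷_) L) _ ⟩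
    count (Q ∘ head) (map (x ∷_) L) + count (Q ∘ head) (concatMap (λ x → map (x ∷_) L) xs)
      ≡⟨ cong₂ _+_ (trans (count-map (Q ∘ head) (x ∷_) L) (count-const (Q x) L)) (count-prefixes xs) ⟩
    count Q [ x ] * length L + count Q xs * length L
      ≡⟨ *-distribʳ-+ (length L) (count Q [ x ]) (count Q xs) ⟨
    (count Q [ x ] + count Q xs) * length L
      ≡⟨ cong (_* length L) (count-∷ Q x xs) ⟨
    count Q (x ∷ xs) * length L ∎
    where open ≡-Reasoning

Sparse : (ℕ → Bool) → Set
Sparse S = ∀ k → ∃ λ M → ∀ m → M ≤ m → k * count S (upTo m) ≤ m

hyperplanes : ∀ {n} → (ℕ → Bool) → Point (suc n) → Bool
hyperplanes S p = S ∣ head p ∣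

sparse⇒densityZero : ∀ {S} n → Sparse S → DensityZero (suc n) (hyperplanes S)
sparse⇒densityZero {S} n sparse k _ with sparse (2 * k)
... | M , sparse-from-M = M , λ m M≤m →
  let c = count (S ∘ ∣_∣) (range m)
      c′ = count S (upTo (suc m))
      k*c≤ : k * c ≤ suc (2 * m)
      k*c≤ = begin
        k * c         ≤⟨ *-monoʳ-≤ k (count-abs-range S m) ⟩
        k * (2 * c′)  ≡⟨ *-assoc k 2 c′ ⟨
        k * 2 * c′    ≡⟨ cong (_* c′) (*-comm k 2) ⟩
        2 * k * c′    ≤⟨ sparse-from-M (suc m) (m≤n⇒m≤1+n M≤m) ⟩
        suc m         ≤⟨ s≤s (m≤m+n m (m + 0)) ⟩
        suc (2 * m)   ∎
  in begin
    k * boxCount (suc n) (hyperplanes S) m   ≡⟨ cong (k *_) (count-head-box (S ∘ ∣_∣) n m) ⟩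
    k * (c * suc (2 * m) ^ n)                ≡⟨ *-assoc k c _ ⟨
    k * c * suc (2 * m) ^ n                  ≤⟨ *-monoˡ-≤ (suc (2 * m) ^ n) k*c≤ ⟩
    suc (2 * m) ^ suc n                      ∎
  where open ≤-Reasoning

module _ {I : Set} {n} (path : I → ℕ → Point n) where

  -- At the cops' τ-th turn the history r 0, …, r τ has τ + 1 entries.
  oblivious : CopStrategy I n
  oblivious history i = path i (pred (length history))

  copsAt-oblivious : ∀ {start} → (∀ i → path i 0 ≡ start i) →
                     ∀ r t i → copsAt start oblivious r t i ≡ path i t
  copsAt-oblivious path₀ r zero    i = sym (path₀ i)
  copsAt-oblivious path₀ r (suc t) i = cong (path i ∘ pred) (length-applyUpTo r (suc (suc t)))

step-∸ : ∀ {n} {f : ℕ → Point n} → (∀ k → Step (f k) (f (suc k))) →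
         ∀ t d → Step (f (t ∸ d)) (f (suc t ∸ d))
step-∸         steps t       zero    = steps t
step-∸ {f = f} steps zero    (suc d) = inj₂ (cong f (sym (0∸n≡0 d)))
step-∸         steps (suc t) (suc d) = step-∸ steps t d

dist₁-refl : ∀ {n} (u : Point n) → dist₁ u u ≡ 0
dist₁-refl []      = refl
dist₁-refl (x ∷ u) = cong₂ _+_ (cong ∣_∣ (ℤ.+-inverseʳ x)) (dist₁-refl u)

∣s◃[1+n]-s◃n∣≡1 : ∀ s n → ∣ (s ◃ suc n) - (s ◃ n) ∣ ≡ 1
∣s◃[1+n]-s◃n∣≡1 s n = begin
  ∣ (s ◃ (1 + n)) - (s ◃ n) ∣           ≡⟨ cong (λ i → ∣ i - (s ◃ n) ∣) (ℤ.◃-distrib-+ s 1 n) ⟩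
  ∣ (s ◃ 1) ℤ.+ (s ◃ n) - (s ◃ n) ∣     ≡⟨ cong ∣_∣ (cancel (s ◃ 1) (s ◃ n)) ⟩
  ∣ s ◃ 1 ∣                             ≡⟨ ℤ.abs-◃ s 1 ⟩
  1                                     ∎
  where
  open ≡-Reasoning
  cancel : ∀ i j → i ℤ.+ j - j ≡ i
  cancel = ℤ-Solver.solve-∀

towardsZero : ℕ → ℤ → ℤ
towardsZero k x = sign x ◃ (∣ x ∣ ∸ k)

towardsZero-◃ : ∀ k s a → towardsZero k (s ◃ a) ≡ s ◃ (a ∸ k)
towardsZero-◃ k s zero    = trans (cong (Sign.+ ◃_) (0∸n≡0 k)) (cong (s ◃_) (sym (0∸n≡0 k)))
towardsZero-◃ k s (suc a) = cong₂ (λ s′ a′ → s′ ◃ (a′ ∸ k)) (ℤ.sign-◃ s (suc a)) (ℤ.abs-◃ s (suc a))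

sweep : ∀ {n} → ℕ → Point (suc n) → Point (suc n)
sweep k (x ∷ xs) = towardsZero k x ∷ xs

sweep-zero : ∀ {n} (p : Point (suc n)) → sweep 0 p ≡ p
sweep-zero (x ∷ xs) = cong (_∷ xs) (ℤ.◃-inverse x)

sweep-step : ∀ {n} k (p : Point (suc n)) → Step (sweep k p) (sweep (suc k) p)
sweep-step k (x ∷ xs) =
  subst (λ a → Step ((sign x ◃ (∣ x ∣ ∸ k)) ∷ xs) ((sign x ◃ a) ∷ xs))
        (pred[m∸n]≡m∸[1+n] ∣ x ∣ k)
        (towards-pred (sign x) (∣ x ∣ ∸ k))
  where
  towards-pred : ∀ s a → Step ((s ◃ a) ∷ xs) ((s ◃ pred a) ∷ xs)
  towards-pred s zero    = inj₂ refl
  towards-pred s (suc a) = inj₁ (cong₂ _+_ (∣s◃[1+n]-s◃n∣≡1 s a) (dist₁-refl xs))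

∣head∣-step : ∀ {n} {u v : Point (suc n)} → Step u v → ∣ head v ∣ ≤ suc ∣ head u ∣
∣head∣-step         (inj₂ refl) = n≤1+n _
∣head∣-step {u = x ∷ xs} {y ∷ ys} (inj₁ adjacent) = begin
  ∣ y ∣                 ≡⟨ cong ∣_∣ (x+[y-x]≡y x y) ⟨
  ∣ x ℤ.+ (y - x) ∣     ≤⟨ ℤ.∣i+j∣≤∣i∣+∣j∣ x (y - x) ⟩
  ∣ x ∣ + ∣ y - x ∣     ≤⟨ +-monoʳ-≤ ∣ x ∣ ∣y-x∣≤1 ⟩
  ∣ x ∣ + 1             ≡⟨ +-comm ∣ x ∣ 1 ⟩
  suc ∣ x ∣             ∎
  where
  open ≤-Reasoning
  x+[y-x]≡y : ∀ x y → x ℤ.+ (y - x) ≡ y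
  x+[y-x]≡y = ℤ-Solver.solve-∀
  ∣y-x∣≤1 : ∣ y - x ∣ ≤ 1
  ∣y-x∣≤1 = subst₂ _≤_ (ℤ.∣i-j∣≡∣j-i∣ x y) adjacent (m≤m+n ∣ x - y ∣ (dist₁ xs ys))

-- The least t with R ≤ g t + t works: it is at most R, and for t > 0 minimality gives
-- g t ≤ g (t ∸ 1) + 1 ≤ R.  The search below carries the steps already taken in s.
catch-up : ∀ (g : ℕ → ℕ) → (∀ t → g (suc t) ≤ suc (g t)) →
           ∀ {R} → g 0 ≤ R → ∃ λ t → g t ≤ R × R ≤ g t + t
catch-up g g-step {R} g₀≤R =
  let t , gₜ≤R , R≤ = search R 0 g g-step g₀≤R (≤-reflexive (sym (+-identityʳ R)))
  in  t , gₜ≤R , subst (λ k → R ≤ g t + k) (+-identityʳ t) R≤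
  where
  search : ∀ fuel s (g : ℕ → ℕ) → (∀ t → g (suc t) ≤ suc (g t)) → g 0 ≤ R → R ≤ fuel + s →
           ∃ λ t → g t ≤ R × R ≤ g t + (t + s)
  search zero       s g g-step g₀≤R R≤s = 0 , g₀≤R , ≤-trans R≤s (m≤n+m s (g 0))
  search (suc fuel) s g g-step g₀≤R R≤ with R ≤? g 0 + s
  ... | yes R≤g₀+s = 0 , g₀≤R , R≤g₀+s
  ... | no  R≰g₀+s =
    let g₁≤R = ≤-trans (g-step 0) (≤-trans (s≤s (m≤m+n (g 0) s)) (≰⇒> R≰g₀+s))
        R≤′  = subst (R ≤_) (sym (+-suc fuel s)) R≤
        t , gₜ≤R , R≤ₜ = search fuel (suc s) (g ∘ suc) (g-step ∘ suc) g₁≤R R≤′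
    in  suc t , gₜ≤R , subst (λ k → R ≤ g (suc t) + k) (+-suc t s) R≤ₜ

Unbounded : (ℕ → Bool) → Set
Unbounded S = ∀ N → ∃ λ R → N ≤ R × S R ≡ true

module Sweep (S : ℕ → Bool) (n : ℕ) where

  Cop : Set
  Cop = Σ (Point (suc n)) (λ p → hyperplanes S p ≡ true) × ℕ

  start : Cop → Point (suc n)
  start ((p , _) , _) = p

  path : Cop → ℕ → Point (suc n)
  path ((p , _) , delay) t = sweep (t ∸ delay) p

  path-zero : ∀ c → path c 0 ≡ start c
  path-zero ((p , _) , delay) = trans (cong (λ k → sweep k p) (0∸n≡0 delay)) (sweep-zero p)

  start-isStartSet : IsStartSet start (hyperplanes S)
  start-isStartSet = (λ ((_ , p∈A) , _) → p∈A) , (λ p p∈A → ((p , p∈A) , 0) , refl)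

  legal : LegalCops start (oblivious path)
  legal r _ t c@((p , _) , delay) =
    subst₂ Step (sym (copsAt-oblivious path path-zero r t c))
                (sym (copsAt-oblivious path path-zero r (suc t) c))
                (step-∸ (λ k → sweep-step k p) t delay)

  swept : ∀ {R} → S R ≡ true → ∀ τ (y : Point (suc n)) → ∣ head y ∣ ≤ R → R ≤ ∣ head y ∣ + τ →
          ∃ λ c → path c τ ≡ y
  swept {R} R∈S τ (y ∷ ys) y≤R R≤y+τ = cop , (begin
    sweep (τ ∸ (τ ∸ (R ∸ ∣ y ∣))) ((sign y ◃ R) ∷ ys)
      ≡⟨ cong (λ k → sweep k ((sign y ◃ R) ∷ ys)) (m∸[m∸n]≡n R∸y≤τ) ⟩
    towardsZero (R ∸ ∣ y ∣) (sign y ◃ R) ∷ ys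
      ≡⟨ cong (_∷ ys) (towardsZero-◃ (R ∸ ∣ y ∣) (sign y) R) ⟩
    (sign y ◃ (R ∸ (R ∸ ∣ y ∣))) ∷ ys
      ≡⟨ cong (λ a → (sign y ◃ a) ∷ ys) (m∸[m∸n]≡n y≤R) ⟩
    (sign y ◃ ∣ y ∣) ∷ ys
      ≡⟨ cong (_∷ ys) (ℤ.◃-inverse y) ⟩
    y ∷ ys
      ∎)
    where
    open ≡-Reasoning
    R∸y≤τ : R ∸ ∣ y ∣ ≤ τ
    R∸y≤τ = m≤n+o⇒m∸n≤o R ∣ y ∣ R≤y+τ
    cop : Cop
    cop = (((sign y ◃ R) ∷ ys) , trans (cong S (ℤ.abs-◃ (sign y) R)) R∈S) , τ ∸ (R ∸ ∣ y ∣)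

  captures : Unbounded S → Captures start (oblivious path)
  captures unbounded r legal-r =
    let g t             = ∣ head (r (suc t)) ∣
        R , g₀≤R , R∈S  = unbounded (g 0)
        t , gₜ≤R , R≤   = catch-up g (λ t → ∣head∣-step (legal-r (suc t))) g₀≤R
        c , hit         = swept R∈S (suc t) (r (suc t)) gₜ≤R (≤-trans R≤ (+-monoʳ-≤ (g t) (n≤1+n t)))
    in  t , c , trans (copsAt-oblivious path path-zero r (suc t) c) hit

-- isSquare y holds iff y is a perfect square, and squaresBelow y = ⌈√y⌉ counts the squares
-- below y; defining them together makes this counting function definitional.
mutual
  squaresBelow : ℕ → ℕ
  squaresBelow zero    = 0
  squaresBelow (suc y) = (if isSquare y then 1 else 0) + squaresBelow y

  isSquare : ℕ → Bool
  isSquare y = squaresBelow y * squaresBelow y ≤ᵇ y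

squaresBelow≡count : ∀ y → squaresBelow y ≡ count isSquare (upTo y)
squaresBelow≡count zero    = refl
squaresBelow≡count (suc y) = begin
  count isSquare [ y ] + squaresBelow y           ≡⟨ cong (count isSquare [ y ] +_) (squaresBelow≡count y) ⟩
  count isSquare [ y ] + count isSquare (upTo y)  ≡⟨ +-comm _ (count isSquare (upTo y)) ⟩
  count isSquare (upTo y) + count isSquare [ y ]  ≡⟨ count-upTo-suc isSquare y ⟨
  count isSquare (upTo (suc y))                   ∎
  where open ≡-Reasoning

isSquare-sound : ∀ y → isSquare y ≡ true → squaresBelow y * squaresBelow y ≤ y
isSquare-sound y eq = ≤ᵇ⇒≤ _ y (subst T (sym eq) tt)

isSquare-complete : ∀ y → squaresBelow y * squaresBelow y ≤ y → isSquare y ≡ true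
isSquare-complete y le with isSquare y | ≤⇒≤ᵇ le
... | true | _ = refl

pred-squaresBelow-squared : ∀ y → pred (squaresBelow y) * pred (squaresBelow y) ≤ y
pred-squaresBelow-squared zero = z≤n
pred-squaresBelow-squared (suc y) with isSquare y in eq
... | true  = m≤n⇒m≤1+n (isSquare-sound y eq)
... | false = m≤n⇒m≤1+n (pred-squaresBelow-squared y)

squaresBelow-nonsquare : ∀ {y} → isSquare y ≡ false → squaresBelow (suc y) ≡ squaresBelow y
squaresBelow-nonsquare {y} eq = cong (λ b → (if b then 1 else 0) + squaresBelow y) eq

isSquare-unbounded : Unbounded isSquare
isSquare-unbounded N = search (squaresBelow N * squaresBelow N) N (m≤n+m _ N)
  where
  search : ∀ d y → squaresBelow y * squaresBelow y ≤ y + d → ∃ λ R → y ≤ R × isSquare R ≡ true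
  search zero    y bound =
    y , ≤-refl , isSquare-complete y (subst (squaresBelow y * squaresBelow y ≤_) (+-identityʳ y) bound)
  search (suc d) y bound with isSquare y in eq
  ... | true  = y , ≤-refl , eq
  ... | false =
    let bound′ = subst (λ s → s * s ≤ suc y + d) (sym (squaresBelow-nonsquare {y} eq))
                       (subst (squaresBelow y * squaresBelow y ≤_) (+-suc y d) bound)
        R , suc-y≤R , R∈S = search d (suc y) bound′
    in  R , <⇒≤ suc-y≤R , R∈S

linear≤square : ∀ k s m → 2 * k * k ≤ m → pred s * pred s ≤ m → k * s ≤ m
linear≤square zero      s       m _ _ = z≤n
linear≤square k         zero    m _ _ = subst (_≤ m) (sym (*-zeroʳ k)) z≤n
linear≤square k@(suc _) (suc p) m 2k²≤m p²≤m with suc p ≤? 2 * k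
... | yes 1+p≤2k = begin
  k * suc p    ≤⟨ *-monoʳ-≤ k 1+p≤2k ⟩
  k * (2 * k)  ≡⟨ *-comm k (2 * k) ⟩
  2 * k * k    ≤⟨ 2k²≤m ⟩
  m            ∎
  where open ≤-Reasoning
... | no 1+p≰2k = begin
  k * suc p    ≤⟨ *-monoʳ-≤ k (+-monoˡ-≤ p (≤-trans (m≤m+n 1 _) 2k≤p)) ⟩
  k * (p + p)  ≡⟨ regroup k p ⟩
  2 * k * p    ≤⟨ *-monoˡ-≤ p 2k≤p ⟩
  p * p        ≤⟨ p²≤m ⟩
  m            ∎
  where
  open ≤-Reasoning
  2k≤p : 2 * k ≤ p
  2k≤p = ≤-pred (≰⇒> 1+p≰2k)
  regroup : ∀ k p → k * (p + p) ≡ 2 * k * p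
  regroup = ℕ-Solver.solve-∀

isSquare-sparse : Sparse isSquare
isSquare-sparse k = 2 * k * k , λ m 2k²≤m →
  subst (λ c → k * c ≤ m) (squaresBelow≡count m)
        (linear≤square k (squaresBelow m) m 2k²≤m (pred-squaresBelow-squared m))

mainTheorem1 : (n : ℕ) → 1 ≤ n →
    Σ Set λ I → Σ (I → Point n) λ start → Σ (Point n → Bool) λ A →
      IsStartSet start A × DensityZero n A ×
      Σ (CopStrategy I n) λ σ → LegalCops start σ × Captures start σ
mainTheorem1 zero    ()
mainTheorem1 (suc n) _ =
  Cop , start , hyperplanes isSquare , start-isStartSet , sparse⇒densityZero n isSquare-sparse ,
  oblivious path , legal , captures isSquare-unbounded
  where open Sweep isSquare n
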